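{- Let $\mathcal{M}$ be a simple matroid on $[n]$ with set of circuits $\mathfrak{C}(\mathcal{M})$, and let $\mathbb{K}$ be a field. For every subset $\mathfrak{C}'\subseteq\mathfrak{C}(\mathcal{M})$ we have $\Im(\mathfrak{C}')=\Im(c\ell_\Delta(\mathfrak{C}'))$.
   Context: $\mathcal{E}=\bigwedge\big(\bigoplus_{i=1}^n\mathbb{K}e_i\big)$ is the exterior algebra over $\mathbb{K}$; for $X=\{i_1<\dots<i_m\}\subseteq[n]$, $e_X=e_{i_1}\wedge\dots\wedge e_{i_m}$ ($e_\emptyset=1$). $\partial:\mathcal{E}\to\mathcal{E}$ is the degree $-1$ linear map with $\partial(e_i)=1$ and $\partial(a\wedge b)=\partial(a)\wedge b+(-1)^{\deg a}a\wedge\partial(b)$, so $\partial(e_X)=\sum_{j}\pm e_{X\setminus\{i_j\}}$ with alternating signs. For $\mathfrak{X}\subseteq2^{[n]}$, $\Im(\mathfrak{X})$ is the two-sided ideal of $\mathcal{E}$ generated by $\{\partial(e_X):X\in\mathfrak{X}\}$. A family $\mathfrak{X}\subseteq2^{[n]}$ is $\Delta$-closed if (i) $X\subseteq X'$, $X\in\mathfrak{X}$ imply $X'\in\mathfrak{X}$; and (ii) $X,X'\in\mathfrak{X}$, $|X|,|X'|\ge2$, $X\cap X'=\{i_\alpha\}$ imply $X\Delta X'\in\mathfrak{X}$. $c\ell_\Delta(\mathfrak{Z})$ is the smallest $\Delta$-closed family containing $\mathfrak{Z}$. -}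

module Defs where

open import Level using (Level; _⊔_) renaming (suc to lsuc; zero to lzero)
open import Data.Nat using (ℕ; zero; suc; _≥_; _≡ᵇ_) renaming (_+_ to _+ℕ_)
open import Data.Bool using (Bool; true; false; if_then_else_; _∧_; _xor_)
open import Data.Vec using (Vec; []; _∷_; zipWith)
open import Data.List using (List; []; _∷_; _++_; map)
open import Data.List.Relation.Unary.All using (All)
open import Data.Product using (Σ; ∃; ∃-syntax; _×_; _,_; proj₁; proj₂)
open import Data.Fin using (Fin)
open import Data.Fin.Subset using (Subset; _∈_; _∉_; _⊆_; _⊂_; _∪_; _∩_; _-_; ⁅_⁆; ∣_∣; ⊥)
open import Relation.Binary.PropositionalEquality using (_≡_; _≢_)
open import Relation.Nullary using (¬_)
open import Algebra.Bundles using (CommutativeRing)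

record IsField {c ℓ} (R : CommutativeRing c ℓ) : Set (c ⊔ ℓ) where
  open CommutativeRing R
  field
    1≉0     : ¬ (1# ≈ 0#)
    inverse : ∀ x → ¬ (x ≈ 0#) → ∃[ y ] (x * y ≈ 1#)

-- Subsets of [n] (as Data.Fin.Subset, index 0 = smallest element)

_Δ_ : ∀ {n} → Subset n → Subset n → Subset n
_Δ_ = zipWith _xor_

allSubsets : ∀ n → List (Subset n)
allSubsets zero    = [] ∷ []
allSubsets (suc n) = map (false ∷_) (allSubsets n) ++ map (true ∷_) (allSubsets n)

-- inv X Y = #{ (x , y) : x ∈ X, y ∈ Y, x > y }
inv : ∀ {n} → Subset n → Subset n → ℕ
inv []      []      = 0
inv (x ∷ X) (y ∷ Y) = (if y then ∣ X ∣ else 0) +ℕ inv X Y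

disjointUnion : ∀ {n} → Subset n → Subset n → Subset n → Bool
disjointUnion []      []      []      = true
disjointUnion (x ∷ X) (y ∷ Y) (z ∷ Z) with x | y | z
... | true  | true  | _     = false
... | true  | false | true  = disjointUnion X Y Z
... | false | true  | true  = disjointUnion X Y Z
... | false | false | false = disjointUnion X Y Z
... | _     | _     | _     = false

Family : ℕ → Set₁
Family n = Subset n → Set

ΔClosed : ∀ {n} → Family n → Set
ΔClosed {n} 𝔛 =
  (∀ X X' → X ⊆ X' → 𝔛 X → 𝔛 X')
  × (∀ X X' (i : Fin n) → 𝔛 X → 𝔛 X' → ∣ X ∣ ≥ 2 → ∣ X' ∣ ≥ 2
       → X ∩ X' ≡ ⁅ i ⁆ → 𝔛 (X Δ X'))

clΔ : ∀ {n} → Family n → Subset n → Set₁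
clΔ {n} ℨ X = (𝔉 : Family n) → ΔClosed 𝔉 → (∀ Y → ℨ Y → 𝔉 Y) → 𝔉 X

record IsSimpleMatroidCircuits {n} (Circ : Family n) : Set where
  field
    nonempty    : ¬ Circ ⊥
    incomparable : ∀ C D → Circ C → Circ D → C ⊆ D → C ≡ D
    elimination : ∀ C D (e : Fin n) → Circ C → Circ D → C ≢ D → e ∈ C → e ∈ D
                  → ∃[ E ] (Circ E × E ⊆ ((C ∪ D) - e))
    -- simple: no loops and no parallel elements, i.e. no circuits of size 1 or 2
    simple      : ∀ C → Circ C → ∣ C ∣ ≥ 3

-- Exterior algebra E = ⋀ (K^n) over a commutative ring K, elements
-- represented by their coefficient vectors in the basis (e_X)_{X ⊆ [n]}.

module ExteriorAlgebra {c ℓ} (R : CommutativeRing c ℓ) where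
  open CommutativeRing R renaming (Carrier to K)

  𝓔 : ℕ → Set c
  𝓔 n = Subset n → K

  _≈ₑ_ : ∀ {n} → 𝓔 n → 𝓔 n → Set ℓ
  a ≈ₑ b = ∀ X → a X ≈ b X

  Σ-list : ∀ {A : Set} → List A → (A → K) → K
  Σ-list []       f = 0#
  Σ-list (x ∷ xs) f = f x + Σ-list xs f

  sgn : ℕ → K
  sgn zero    = 1#
  sgn (suc k) = - sgn k

  [_]? : Bool → K → K
  [ b ]? k = if b then k else 0#

  zeroₑ : ∀ {n} → 𝓔 n
  zeroₑ _ = 0#

  _+ₑ_ : ∀ {n} → 𝓔 n → 𝓔 n → 𝓔 n
  (a +ₑ b) X = a X + b X

  e : ∀ {n} → Subset n → 𝓔 n
  e {n} X Y = [ disjointUnion X ⊥ Y ]? 1#   -- disjointUnion X ∅ Y  ⇔  X = Y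

  -- wedge product:  e_X ∧ e_Y = 0 if X ∩ Y ≠ ∅, else (-1)^{inv X Y} e_{X ∪ Y}
  _∧ₑ_ : ∀ {n} → 𝓔 n → 𝓔 n → 𝓔 n
  _∧ₑ_ {n} a b Z =
    Σ-list (allSubsets n) λ X → Σ-list (allSubsets n) λ Y →
      [ disjointUnion X Y Z ]? (sgn (inv X Y) * (a X * b Y))

  -- the derivation ∂ (degree -1, ∂ e_i = 1, graded Leibniz rule), linearly:
  -- ∂(e_X) = Σ_j (-1)^{j-1} e_{X ∖ {i_j}};  the coefficient of e_Y in ∂ a is
  -- Σ_{i ∉ Y} (-1)^{#{y ∈ Y : y < i}} a(Y ∪ {i}) = Σ_{S, |S| = 1} (-1)^{inv S Y} a(S ⊔ Y).
  ∂ : ∀ {n} → 𝓔 n → 𝓔 n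
  ∂ {n} a Y =
    Σ-list (allSubsets n) λ S → Σ-list (allSubsets n) λ X →
      [ isSingleton S ∧ disjointUnion S Y X ]? (sgn (inv S Y) * a X)
    where
    isSingleton : Subset n → Bool
    isSingleton S = ∣ S ∣ ≡ᵇ 1

  -- two-sided ideal generated by { ∂(e_X) : X ∈ 𝔛 }:
  -- all finite sums Σ a_k ∧ ∂(e_{X_k}) ∧ b_k with X_k ∈ 𝔛.
  Ideal : ∀ {n a} → (Subset n → Set a) → 𝓔 n → Set (c ⊔ ℓ ⊔ a)
  Ideal {n} 𝔛 x =
    Σ (List (𝓔 n × Subset n × 𝓔 n)) λ ts →
      All (λ t → 𝔛 (proj₁ (proj₂ t))) ts
      × (x ≈ₑ Σ-list' ts)
    where
    Σ-list' : List (𝓔 n × Subset n × 𝓔 n) → 𝓔 n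
    Σ-list' []                  = zeroₑ
    Σ-list' ((a , X , b) ∷ ts) = ((a ∧ₑ ∂ (e X)) ∧ₑ b) +ₑ Σ-list' ts

{-# OPTIONS --safe #-}
module Submission where

-- The ideal I generated by the ∂e_X, X ∈ 𝔛, contains e_X for every nonempty X ∈ 𝔛: for
-- i ∈ X we have e_i ∧ e_X = 0, and left multiplication by e_i is a contracting homotopy,
-- ∂(e_i ∧ a) + e_i ∧ ∂a = a, so e_X = e_i ∧ ∂e_X. The sets X with e_X ∈ I form a Δ-closed
-- family: e_Y = ±e_{Y∖X} ∧ e_X for X ⊆ Y, and if X ∩ Y = {i}, A = X∖i, B = Y∖i, then
-- e_{XΔY} = ±e_A ∧ e_B = ±(e_A ∧ ∂(e_i ∧ e_B) + (e_A ∧ e_i) ∧ ∂e_B), where e_i ∧ e_B = ±e_Y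
-- and e_A ∧ e_i = ±e_X lie in I, and I is closed under ∂ by the Leibniz rule and ∂∂ = 0.
-- Hence ∂e_X ∈ I for all X ∈ clΔ(𝔛). That circuits of a simple matroid are nonempty is all
-- that is used about matroids.

open import Defs
open import Algebra.Bundles using (CommutativeRing)
import Algebra.Properties.Ring as RingProperties
import Algebra.Solver.CommutativeMonoid as CommutativeMonoidSolver
open import Data.Bool using (Bool; true; false; _∧_)
open import Data.Fin using (Fin; zero; suc)
open import Data.Fin.Subset using (Subset; _∈_; _⊆_; _∩_; _∪_; _─_; ⁅_⁆; ∣_∣; ⊥; Nonempty)
open import Data.Fin.Subset.Properties
  using (x∈⁅x⁆; x∈⁅y⁆⇒x≡y; ∣⊥∣≡0; ∣⁅x⁆∣≡1; x∈p∩q⁻; ∩-comm; ∪-comm; drop-∷-⊆)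
open import Data.List using (List; []; _∷_; _++_; map)
open import Data.List.Relation.Unary.All using ([]; _∷_)
open import Data.Nat using (ℕ; zero; suc; _≡ᵇ_; _≤_; s≤s; z≤n) renaming (_+_ to _+ℕ_)
open import Data.Nat.Properties using (≤-trans)
open import Data.Product using (_×_; _,_; proj₁; proj₂)
import Data.Product as Product
open import Data.Vec using ([]; _∷_; here; there)
open import Data.Vec.Properties using (∷-injectiveʳ)
open import Function using (_∘_)
open import Relation.Binary.PropositionalEquality as ≡ using (_≡_)
import Relation.Binary.Reasoning.Setoid as SetoidReasoning

variable
  n : ℕ

p─q∩q≡⊥ : (p q : Subset n) → (p ─ q) ∩ q ≡ ⊥
p─q∩q≡⊥ []          []          = ≡.refl
p─q∩q≡⊥ (x ∷ p)     (true ∷ q)  = ≡.cong (false ∷_) (p─q∩q≡⊥ p q)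
p─q∩q≡⊥ (true ∷ p)  (false ∷ q) = ≡.cong (false ∷_) (p─q∩q≡⊥ p q)
p─q∩q≡⊥ (false ∷ p) (false ∷ q) = ≡.cong (false ∷_) (p─q∩q≡⊥ p q)

q⊆p⇒p─q∪q≡p : (p q : Subset n) → q ⊆ p → (p ─ q) ∪ q ≡ p
q⊆p⇒p─q∪q≡p []          []          _   = ≡.refl
q⊆p⇒p─q∪q≡p (true ∷ p)  (true ∷ q)  q⊆p = ≡.cong (true ∷_) (q⊆p⇒p─q∪q≡p p q (drop-∷-⊆ q⊆p))
q⊆p⇒p─q∪q≡p (false ∷ p) (true ∷ q)  q⊆p with q⊆p here
... | ()
q⊆p⇒p─q∪q≡p (true ∷ p)  (false ∷ q) q⊆p = ≡.cong (true ∷_) (q⊆p⇒p─q∪q≡p p q (drop-∷-⊆ q⊆p))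
q⊆p⇒p─q∪q≡p (false ∷ p) (false ∷ q) q⊆p = ≡.cong (false ∷_) (q⊆p⇒p─q∪q≡p p q (drop-∷-⊆ q⊆p))

p─[p∩q]∩q─[p∩q]≡⊥ : (p q : Subset n) → (p ─ (p ∩ q)) ∩ (q ─ (p ∩ q)) ≡ ⊥
p─[p∩q]∩q─[p∩q]≡⊥ []          []          = ≡.refl
p─[p∩q]∩q─[p∩q]≡⊥ (true ∷ p)  (true ∷ q)  = ≡.cong (false ∷_) (p─[p∩q]∩q─[p∩q]≡⊥ p q)
p─[p∩q]∩q─[p∩q]≡⊥ (true ∷ p)  (false ∷ q) = ≡.cong (false ∷_) (p─[p∩q]∩q─[p∩q]≡⊥ p q)
p─[p∩q]∩q─[p∩q]≡⊥ (false ∷ p) (true ∷ q)  = ≡.cong (false ∷_) (p─[p∩q]∩q─[p∩q]≡⊥ p q)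
p─[p∩q]∩q─[p∩q]≡⊥ (false ∷ p) (false ∷ q) = ≡.cong (false ∷_) (p─[p∩q]∩q─[p∩q]≡⊥ p q)

p─[p∩q]∪q─[p∩q]≡pΔq : (p q : Subset n) → (p ─ (p ∩ q)) ∪ (q ─ (p ∩ q)) ≡ p Δ q
p─[p∩q]∪q─[p∩q]≡pΔq []          []          = ≡.refl
p─[p∩q]∪q─[p∩q]≡pΔq (true ∷ p)  (true ∷ q)  = ≡.cong (false ∷_) (p─[p∩q]∪q─[p∩q]≡pΔq p q)
p─[p∩q]∪q─[p∩q]≡pΔq (true ∷ p)  (false ∷ q) = ≡.cong (true ∷_) (p─[p∩q]∪q─[p∩q]≡pΔq p q)
p─[p∩q]∪q─[p∩q]≡pΔq (false ∷ p) (true ∷ q)  = ≡.cong (true ∷_) (p─[p∩q]∪q─[p∩q]≡pΔq p q)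
p─[p∩q]∪q─[p∩q]≡pΔq (false ∷ p) (false ∷ q) = ≡.cong (false ∷_) (p─[p∩q]∪q─[p∩q]≡pΔq p q)

x∈p⇒⁅x⁆⊆p : ∀ {x : Fin n} {p} → x ∈ p → ⁅ x ⁆ ⊆ p
x∈p⇒⁅x⁆⊆p {x = x} x∈p y∈⁅x⁆ = ≡.subst (_∈ _) (≡.sym (x∈⁅y⁆⇒x≡y x y∈⁅x⁆)) x∈p

1≤∣p∣⇒Nonempty : (p : Subset n) → 1 ≤ ∣ p ∣ → Nonempty p
1≤∣p∣⇒Nonempty (true ∷ p)  _     = zero , here
1≤∣p∣⇒Nonempty (false ∷ p) 1≤∣p∣ = Product.map suc there (1≤∣p∣⇒Nonempty p 1≤∣p∣)

data Δ-generated (ℨ : Family n) : Family n where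
  generator : ∀ {X} → ℨ X → Δ-generated ℨ X
  superset  : ∀ {X Y} → X ⊆ Y → Δ-generated ℨ X → Δ-generated ℨ Y
  glue      : ∀ {X Y} (i : Fin n) → X ∩ Y ≡ ⁅ i ⁆ →
              Δ-generated ℨ X → Δ-generated ℨ Y → Δ-generated ℨ (X Δ Y)

Δ-generated-ΔClosed : (ℨ : Family n) → ΔClosed (Δ-generated ℨ)
Δ-generated-ΔClosed ℨ =
  (λ _ _ X⊆Y → superset X⊆Y) , (λ _ _ i gX gY _ _ X∩Y≡⁅i⁆ → glue i X∩Y≡⁅i⁆ gX gY)

clΔ⊆Δ-generated : (ℨ : Family n) → ∀ {X} → clΔ ℨ X → Δ-generated ℨ X
clΔ⊆Δ-generated ℨ X∈clΔ = X∈clΔ (Δ-generated ℨ) (Δ-generated-ΔClosed ℨ) (λ _ → generator)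

module ExteriorAlgebraProperties {c ℓ} (R : CommutativeRing c ℓ) where
  open CommutativeRing R renaming (Carrier to K) hiding (zero)
  open ExteriorAlgebra R
    renaming (_∧ₑ_ to infixr 7 _∧ₑ_; _+ₑ_ to infixl 6 _+ₑ_; _≈ₑ_ to infix 4 _≈ₑ_)
  open RingProperties ring
    using (-‿distribˡ-*; -‿distribʳ-*; -‿involutive; -‿+-comm; -0#≈0#; -1*x≈-x)
  open SetoidReasoning setoid
  module +-Solver = CommutativeMonoidSolver +-commutativeMonoid
  module *-Solver = CommutativeMonoidSolver *-commutativeMonoid
  open +-Solver using () renaming (_⊕_ to _⊕⁺_; _⊜_ to _⊜⁺_)
  open *-Solver using () renaming (_⊕_ to _⊕*_; _⊜_ to _⊜*_)

  x+0≈x : ∀ {x y} → y ≈ 0# → x + y ≈ x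
  x+0≈x y≈0 = trans (+-congˡ y≈0) (+-identityʳ _)

  0+y≈y : ∀ {x y} → x ≈ 0# → x + y ≈ y
  0+y≈y x≈0 = trans (+-congʳ x≈0) (+-identityˡ _)

  0+0≈0 : ∀ {x y} → x ≈ 0# → y ≈ 0# → x + y ≈ 0#
  0+0≈0 x≈0 y≈0 = trans (0+y≈y x≈0) y≈0

  -x*-y≈x*y : ∀ x y → (- x) * (- y) ≈ x * y
  -x*-y≈x*y x y =
    trans (sym (-‿distribˡ-* _ _)) (trans (-‿cong (sym (-‿distribʳ-* _ _))) (-‿involutive _))

  -‿distrib-+ : ∀ x y → - (x + y) ≈ - x + - y
  -‿distrib-+ x y = sym (-‿+-comm x y)

  Σ-cong : ∀ {A : Set} (xs : List A) {f g : A → K} → (∀ x → f x ≈ g x) →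
           Σ-list xs f ≈ Σ-list xs g
  Σ-cong []       f≈g = refl
  Σ-cong (x ∷ xs) f≈g = +-cong (f≈g x) (Σ-cong xs f≈g)

  Σ-zero : ∀ {A : Set} (xs : List A) → Σ-list xs (λ _ → 0#) ≈ 0#
  Σ-zero []       = refl
  Σ-zero (x ∷ xs) = trans (+-identityˡ _) (Σ-zero xs)

  ΣΣ-zero : ∀ {A B : Set} (xs : List A) (ys : List B) → Σ-list xs (λ _ → Σ-list ys (λ _ → 0#)) ≈ 0#
  ΣΣ-zero xs ys = trans (Σ-cong xs (λ _ → Σ-zero ys)) (Σ-zero xs)

  Σ-++ : ∀ {A : Set} (xs ys : List A) (f : A → K) → Σ-list (xs ++ ys) f ≈ Σ-list xs f + Σ-list ys f
  Σ-++ []       ys f = sym (+-identityˡ _)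
  Σ-++ (x ∷ xs) ys f = trans (+-congˡ (Σ-++ xs ys f)) (sym (+-assoc _ _ _))

  Σ-map : ∀ {A B : Set} (h : A → B) (xs : List A) (f : B → K) → Σ-list (map h xs) f ≈ Σ-list xs (f ∘ h)
  Σ-map h []       f = refl
  Σ-map h (x ∷ xs) f = +-congˡ (Σ-map h xs f)

  Σ-+ : ∀ {A : Set} (xs : List A) (f g : A → K) →
        Σ-list xs (λ x → f x + g x) ≈ Σ-list xs f + Σ-list xs g
  Σ-+ []       f g = sym (+-identityˡ _)
  Σ-+ (x ∷ xs) f g = trans (+-congˡ (Σ-+ xs f g))
    (+-Solver.solve 4 (λ a b c d → (a ⊕⁺ b) ⊕⁺ (c ⊕⁺ d) ⊜⁺ (a ⊕⁺ c) ⊕⁺ (b ⊕⁺ d)) refl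
      (f x) (g x) (Σ-list xs f) (Σ-list xs g))

  Σ-* : ∀ {A : Set} (xs : List A) (k : K) (f : A → K) → Σ-list xs (λ x → k * f x) ≈ k * Σ-list xs f
  Σ-* []       k f = sym (zeroʳ k)
  Σ-* (x ∷ xs) k f = trans (+-congˡ (Σ-* xs k f)) (sym (distribˡ k _ _))

  Σ-neg : ∀ {A : Set} (xs : List A) (f : A → K) → Σ-list xs (λ x → - f x) ≈ - Σ-list xs f
  Σ-neg []       f = sym -0#≈0#
  Σ-neg (x ∷ xs) f = trans (+-congˡ (Σ-neg xs f)) (-‿+-comm _ _)

  Σ-allSubsets-suc : ∀ n (f : Subset (suc n) → K) →
    Σ-list (allSubsets (suc n)) f
      ≈ Σ-list (allSubsets n) (f ∘ (false ∷_)) + Σ-list (allSubsets n) (f ∘ (true ∷_))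
  Σ-allSubsets-suc n f = trans (Σ-++ (map (false ∷_) (allSubsets n)) _ f)
    (+-cong (Σ-map _ (allSubsets n) f) (Σ-map _ (allSubsets n) f))

  ΣΣ-allSubsets-suc : ∀ n (F : Subset (suc n) → Subset (suc n) → K) →
    Σ-list (allSubsets (suc n)) (λ X → Σ-list (allSubsets (suc n)) (F X))
      ≈ (Σ-list (allSubsets n) (λ X → Σ-list (allSubsets n) (λ Y → F (false ∷ X) (false ∷ Y)))
         + Σ-list (allSubsets n) (λ X → Σ-list (allSubsets n) (λ Y → F (false ∷ X) (true ∷ Y))))
      + (Σ-list (allSubsets n) (λ X → Σ-list (allSubsets n) (λ Y → F (true ∷ X) (false ∷ Y)))
         + Σ-list (allSubsets n) (λ X → Σ-list (allSubsets n) (λ Y → F (true ∷ X) (true ∷ Y))))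
  ΣΣ-allSubsets-suc n F = trans (Σ-allSubsets-suc n _) (+-cong
    (trans (Σ-cong (allSubsets n) (λ X → Σ-allSubsets-suc n _)) (Σ-+ (allSubsets n) _ _))
    (trans (Σ-cong (allSubsets n) (λ X → Σ-allSubsets-suc n _)) (Σ-+ (allSubsets n) _ _)))

  ?-cong : ∀ b {x y} → x ≈ y → [ b ]? x ≈ [ b ]? y
  ?-cong true  x≈y = x≈y
  ?-cong false x≈y = refl

  ?-zero : ∀ b → [ b ]? 0# ≈ 0#
  ?-zero true  = refl
  ?-zero false = refl

  ?-+ : ∀ b x y → [ b ]? (x + y) ≈ [ b ]? x + [ b ]? y
  ?-+ true  x y = refl
  ?-+ false x y = sym (+-identityˡ _)

  ?-* : ∀ b k x → [ b ]? (k * x) ≈ k * [ b ]? x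
  ?-* true  k x = refl
  ?-* false k x = sym (zeroʳ k)

  ?-neg : ∀ b x → [ b ]? (- x) ≈ - [ b ]? x
  ?-neg true  x = refl
  ?-neg false x = sym -0#≈0#

  ?-∧ : ∀ b d x → [ b ∧ d ]? x ≈ [ b ]? ([ d ]? x)
  ?-∧ true  d x = refl
  ?-∧ false d x = refl

  Σ-? : ∀ {A : Set} (xs : List A) b (f : A → K) → Σ-list xs (λ x → [ b ]? (f x)) ≈ [ b ]? (Σ-list xs f)
  Σ-? xs true  f = refl
  Σ-? xs false f = Σ-zero xs

  sgn-+ : ∀ m k → sgn (m +ℕ k) ≈ sgn m * sgn k
  sgn-+ zero    k = sym (*-identityˡ _)
  sgn-+ (suc m) k = trans (-‿cong (sgn-+ m k)) (-‿distribˡ-* _ _)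

  sgn*sgn≈1 : ∀ m → sgn m * sgn m ≈ 1#
  sgn*sgn≈1 zero    = *-identityˡ _
  sgn*sgn≈1 (suc m) = trans (-x*-y≈x*y _ _) (sgn*sgn≈1 m)

  infix  8 -ₑ_
  infixr 8 _·ₑ_

  -ₑ_ : 𝓔 n → 𝓔 n
  (-ₑ a) X = - a X

  _·ₑ_ : K → 𝓔 n → 𝓔 n
  (k ·ₑ a) X = k * a X

  1ₑ : 𝓔 n
  1ₑ = e ⊥

  α : 𝓔 n → 𝓔 n
  α a X = sgn ∣ X ∣ * a X

  -- a = lo a + e₀ ∧ hi a
  lo hi : 𝓔 (suc n) → 𝓔 n
  lo a Z = a (false ∷ Z)
  hi a Z = a (true ∷ Z)

  ≈ₑ-sym : {a b : 𝓔 n} → a ≈ₑ b → b ≈ₑ a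
  ≈ₑ-sym a≈b X = sym (a≈b X)

  inv-⊥ : (Y : Subset n) → inv ⊥ Y ≡ 0
  inv-⊥ []                 = ≡.refl
  inv-⊥ (false ∷ Y)        = inv-⊥ Y
  inv-⊥ {suc n} (true ∷ Y) = ≡.cong₂ _+ℕ_ (∣⊥∣≡0 n) (inv-⊥ Y)

  ∧ₑ-[] : (a b : 𝓔 0) → (a ∧ₑ b) [] ≈ a [] * b []
  ∧ₑ-[] a b = trans (+-identityʳ _) (trans (+-identityʳ _) (*-identityˡ _))

  ∂-[] : (a : 𝓔 0) → ∂ a [] ≈ 0#
  ∂-[] a = trans (+-identityʳ _) (+-identityʳ _)

  ∧ₑ-lo : (a b : 𝓔 (suc n)) (Z : Subset n) → (a ∧ₑ b) (false ∷ Z) ≈ (lo a ∧ₑ lo b) Z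
  ∧ₑ-lo {n} a b Z = trans (ΣΣ-allSubsets-suc n _)
    (trans (+-cong (x+0≈x (ΣΣ-zero ss ss)) (0+y≈y (ΣΣ-zero ss ss))) (x+0≈x (ΣΣ-zero ss ss)))
    where ss = allSubsets n

  ∧ₑ-hi : (a b : 𝓔 (suc n)) (Z : Subset n) →
          (a ∧ₑ b) (true ∷ Z) ≈ (hi a ∧ₑ lo b) Z + (α (lo a) ∧ₑ hi b) Z
  ∧ₑ-hi {n} a b Z = trans (ΣΣ-allSubsets-suc n _)
    (trans (+-cong (0+y≈y (ΣΣ-zero ss ss)) (x+0≈x (ΣΣ-zero ss ss)))
      (trans (+-comm _ _)
        (+-congˡ (Σ-cong ss λ X → Σ-cong ss λ Y → ?-cong (disjointUnion X Y Z) (sign X Y)))))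
    where
    ss = allSubsets n
    sign : ∀ X Y → sgn (∣ X ∣ +ℕ inv X Y) * (a (false ∷ X) * b (true ∷ Y))
                   ≈ sgn (inv X Y) * ((sgn ∣ X ∣ * a (false ∷ X)) * b (true ∷ Y))
    sign X Y = trans (*-congʳ (sgn-+ ∣ X ∣ (inv X Y)))
      (*-Solver.solve 4 (λ s t u v → (s ⊕* t) ⊕* (u ⊕* v) ⊜* t ⊕* ((s ⊕* u) ⊕* v)) refl
        (sgn ∣ X ∣) (sgn (inv X Y)) (a (false ∷ X)) (b (true ∷ Y)))

  private
    Σ-guard-∧-false : ∀ n (p : Subset n → Bool) (g : Subset n → Subset n → K) →
      Σ-list (allSubsets n) (λ S → Σ-list (allSubsets n) (λ X → [ p S ∧ false ]? (g S X))) ≈ 0#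
    Σ-guard-∧-false n p g = trans
      (Σ-cong ss λ S → trans (Σ-cong ss λ X → trans (?-∧ (p S) false _) (?-zero (p S))) (Σ-zero ss))
      (Σ-zero ss)
      where ss = allSubsets n

    Σ-guard-∣∣≡0 : ∀ n (h : Subset n → K) → Σ-list (allSubsets n) (λ S → [ ∣ S ∣ ≡ᵇ 0 ]? (h S)) ≈ h ⊥
    Σ-guard-∣∣≡0 zero    h = +-identityʳ _
    Σ-guard-∣∣≡0 (suc n) h = trans (Σ-allSubsets-suc n _)
      (trans (x+0≈x (Σ-zero (allSubsets n))) (Σ-guard-∣∣≡0 n (h ∘ (false ∷_))))

    Σ-guard-⊥⊎ : ∀ n (Y : Subset n) (g : Subset n → K) →
                 Σ-list (allSubsets n) (λ X → [ disjointUnion ⊥ Y X ]? (g X)) ≈ g Y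
    Σ-guard-⊥⊎ zero    []          g = +-identityʳ _
    Σ-guard-⊥⊎ (suc n) (false ∷ Y) g = trans (Σ-allSubsets-suc n _)
      (trans (x+0≈x (Σ-zero (allSubsets n))) (Σ-guard-⊥⊎ n Y (g ∘ (false ∷_))))
    Σ-guard-⊥⊎ (suc n) (true ∷ Y)  g = trans (Σ-allSubsets-suc n _)
      (trans (0+y≈y (Σ-zero (allSubsets n))) (Σ-guard-⊥⊎ n Y (g ∘ (true ∷_))))

    singleton-guard-sgn-+ : ∀ m d i v →
      [ (m ≡ᵇ 1) ∧ d ]? (sgn (m +ℕ i) * v) ≈ - [ (m ≡ᵇ 1) ∧ d ]? (sgn i * v)
    singleton-guard-sgn-+ zero          d i v = sym -0#≈0#
    singleton-guard-sgn-+ (suc zero)    d i v = trans (?-cong d (sym (-‿distribˡ-* _ _))) (?-neg d _)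
    singleton-guard-sgn-+ (suc (suc m)) d i v = sym -0#≈0#

  ∂-lo : (a : 𝓔 (suc n)) (Y : Subset n) → ∂ a (false ∷ Y) ≈ ∂ (lo a) Y + hi a Y
  ∂-lo {n} a Y = trans (ΣΣ-allSubsets-suc n _)
    (+-cong (x+0≈x (Σ-guard-∧-false n (λ S → ∣ S ∣ ≡ᵇ 1) _))
            (trans (0+y≈y (Σ-guard-∧-false n (λ S → ∣ S ∣ ≡ᵇ 0) _)) take-e₀))
    where
    ss = allSubsets n
    take-e₀ : Σ-list ss (λ S → Σ-list ss (λ X →
                [ (∣ S ∣ ≡ᵇ 0) ∧ disjointUnion S Y X ]? (sgn (inv S Y) * a (true ∷ X))))
              ≈ a (true ∷ Y)
    take-e₀ = begin
      Σ-list ss (λ S → Σ-list ss (λ X →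
        [ (∣ S ∣ ≡ᵇ 0) ∧ disjointUnion S Y X ]? (sgn (inv S Y) * a (true ∷ X))))
        ≈⟨ Σ-cong ss (λ S → trans (Σ-cong ss (λ X → ?-∧ (∣ S ∣ ≡ᵇ 0) _ _)) (Σ-? ss (∣ S ∣ ≡ᵇ 0) _)) ⟩
      Σ-list ss (λ S → [ ∣ S ∣ ≡ᵇ 0 ]? (Σ-list ss (λ X →
        [ disjointUnion S Y X ]? (sgn (inv S Y) * a (true ∷ X)))))
        ≈⟨ Σ-guard-∣∣≡0 n _ ⟩
      Σ-list ss (λ X → [ disjointUnion ⊥ Y X ]? (sgn (inv ⊥ Y) * a (true ∷ X)))
        ≈⟨ Σ-guard-⊥⊎ n Y _ ⟩
      sgn (inv ⊥ Y) * a (true ∷ Y)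
        ≈⟨ *-congʳ (reflexive (≡.cong sgn (inv-⊥ Y))) ⟩
      1# * a (true ∷ Y)
        ≈⟨ *-identityˡ _ ⟩
      a (true ∷ Y) ∎

  ∂-hi : (a : 𝓔 (suc n)) (Y : Subset n) → ∂ a (true ∷ Y) ≈ - ∂ (hi a) Y
  ∂-hi {n} a Y = trans (ΣΣ-allSubsets-suc n _)
    (trans (trans (+-congʳ (0+y≈y (vanishing 1 _))) (x+0≈x (0+0≈0 (vanishing 0 _) (vanishing 0 _))))
      (trans (Σ-cong ss λ S → trans (Σ-cong ss λ X → flip S X) (Σ-neg ss _)) (Σ-neg ss _)))
    where
    ss = allSubsets n
    vanishing = λ k → Σ-guard-∧-false n (λ S → ∣ S ∣ ≡ᵇ k)
    flip = λ S X → singleton-guard-sgn-+ ∣ S ∣ (disjointUnion S Y X) (inv S Y) (a (true ∷ X))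

  ∧ₑ-by-products-· : {a b a′ b′ : 𝓔 n} → ∀ k → (∀ X Y → a X * b Y ≈ k * (a′ X * b′ Y)) →
                     a ∧ₑ b ≈ₑ k ·ₑ (a′ ∧ₑ b′)
  ∧ₑ-by-products-· {n} {a} {b} {a′} {b′} k ab≈kab′ Z = trans
    (Σ-cong ss λ X → trans (Σ-cong ss λ Y → trans (?-cong (guard X Y) (sign X Y)) (?-* (guard X Y) k _))
                           (Σ-* ss k _))
    (Σ-* ss k _)
    where
    ss = allSubsets n
    guard = λ X Y → disjointUnion X Y Z
    sign : ∀ X Y → sgn (inv X Y) * (a X * b Y) ≈ k * (sgn (inv X Y) * (a′ X * b′ Y))
    sign X Y = trans (*-congˡ (ab≈kab′ X Y))
      (*-Solver.solve 3 (λ s k p → s ⊕* (k ⊕* p) ⊜* k ⊕* (s ⊕* p)) refl (sgn (inv X Y)) k (a′ X * b′ Y))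

  ∧ₑ-by-products-0 : {a b : 𝓔 n} → (∀ X Y → a X * b Y ≈ 0#) → a ∧ₑ b ≈ₑ zeroₑ
  ∧ₑ-by-products-0 {n} ab≈0 Z = trans
    (Σ-cong ss λ X → trans (Σ-cong ss λ Y → trans (?-cong (guard X Y) (trans (*-congˡ (ab≈0 X Y)) (zeroʳ _)))
                                                  (?-zero (guard X Y)))
                           (Σ-zero ss))
    (Σ-zero ss)
    where
    ss = allSubsets n
    guard = λ X Y → disjointUnion X Y Z

  ∧ₑ-by-products-+ : {a b a′ b′ a″ b″ : 𝓔 n} → (∀ X Y → a X * b Y ≈ a′ X * b′ Y + a″ X * b″ Y) →
                     a ∧ₑ b ≈ₑ a′ ∧ₑ b′ +ₑ a″ ∧ₑ b″
  ∧ₑ-by-products-+ {n} ab≈ Z = trans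
    (Σ-cong ss λ X → trans (Σ-cong ss λ Y → trans (?-cong (guard X Y) (trans (*-congˡ (ab≈ X Y)) (distribˡ _ _ _)))
                                                  (?-+ (guard X Y) _ _))
                           (Σ-+ ss _ _))
    (Σ-+ ss _ _)
    where
    ss = allSubsets n
    guard = λ X Y → disjointUnion X Y Z

  ∧ₑ-cong : {a a′ b b′ : 𝓔 n} → a ≈ₑ a′ → b ≈ₑ b′ → a ∧ₑ b ≈ₑ a′ ∧ₑ b′
  ∧ₑ-cong {n} a≈a′ b≈b′ Z = Σ-cong (allSubsets n) λ X → Σ-cong (allSubsets n) λ Y →
    ?-cong (disjointUnion X Y Z) (*-congˡ (*-cong (a≈a′ X) (b≈b′ Y)))

  ∧ₑ-congˡ : {a b b′ : 𝓔 n} → b ≈ₑ b′ → a ∧ₑ b ≈ₑ a ∧ₑ b′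
  ∧ₑ-congˡ = ∧ₑ-cong (λ _ → refl)

  ∧ₑ-congʳ : {a a′ b : 𝓔 n} → a ≈ₑ a′ → a ∧ₑ b ≈ₑ a′ ∧ₑ b
  ∧ₑ-congʳ a≈a′ = ∧ₑ-cong a≈a′ (λ _ → refl)

  ∧ₑ-distribʳ-+ₑ : (a b c : 𝓔 n) → (a +ₑ b) ∧ₑ c ≈ₑ a ∧ₑ c +ₑ b ∧ₑ c
  ∧ₑ-distribʳ-+ₑ a b c = ∧ₑ-by-products-+ (λ X Y → distribʳ _ _ _)

  ∧ₑ-distribˡ-+ₑ : (a b c : 𝓔 n) → a ∧ₑ (b +ₑ c) ≈ₑ a ∧ₑ b +ₑ a ∧ₑ c
  ∧ₑ-distribˡ-+ₑ a b c = ∧ₑ-by-products-+ (λ X Y → distribˡ _ _ _)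

  ·ₑ-∧ₑ : ∀ k (a b : 𝓔 n) → (k ·ₑ a) ∧ₑ b ≈ₑ k ·ₑ (a ∧ₑ b)
  ·ₑ-∧ₑ k a b = ∧ₑ-by-products-· k (λ X Y → *-assoc _ _ _)

  -ₑ‿distribˡ-∧ₑ : (a b : 𝓔 n) → (-ₑ a) ∧ₑ b ≈ₑ -ₑ (a ∧ₑ b)
  -ₑ‿distribˡ-∧ₑ a b Z = trans (∧ₑ-by-products-· (- 1#) -ab≈-1ab Z) (-1*x≈-x _)
    where
    -ab≈-1ab : ∀ X Y → - a X * b Y ≈ - 1# * (a X * b Y)
    -ab≈-1ab X Y = trans (*-congʳ (sym (-1*x≈-x _))) (*-assoc _ _ _)

  -ₑ‿distribʳ-∧ₑ : (a b : 𝓔 n) → a ∧ₑ (-ₑ b) ≈ₑ -ₑ (a ∧ₑ b)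
  -ₑ‿distribʳ-∧ₑ a b Z = trans (∧ₑ-by-products-· (- 1#) a-b≈-1ab Z) (-1*x≈-x _)
    where
    a-b≈-1ab : ∀ X Y → a X * - b Y ≈ - 1# * (a X * b Y)
    a-b≈-1ab X Y = trans (sym (-‿distribʳ-* _ _)) (sym (-1*x≈-x _))

  ∧ₑ-zeroˡ : (b : 𝓔 n) → zeroₑ ∧ₑ b ≈ₑ zeroₑ
  ∧ₑ-zeroˡ b = ∧ₑ-by-products-0 (λ X Y → zeroˡ _)

  ∧ₑ-zeroʳ : (a : 𝓔 n) → a ∧ₑ zeroₑ ≈ₑ zeroₑ
  ∧ₑ-zeroʳ a = ∧ₑ-by-products-0 (λ X Y → zeroʳ _)

  ∂-by-coefficients-· : {a a′ : 𝓔 n} → ∀ k → (∀ X → a X ≈ k * a′ X) → ∂ a ≈ₑ k ·ₑ ∂ a′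
  ∂-by-coefficients-· {n} {a} {a′} k a≈ka′ Y = trans
    (Σ-cong ss λ S → trans (Σ-cong ss λ X → trans (?-cong (guard S X) (sign S X)) (?-* (guard S X) k _))
                           (Σ-* ss k _))
    (Σ-* ss k _)
    where
    ss = allSubsets n
    guard = λ S X → (∣ S ∣ ≡ᵇ 1) ∧ disjointUnion S Y X
    sign : ∀ S X → sgn (inv S Y) * a X ≈ k * (sgn (inv S Y) * a′ X)
    sign S X = trans (*-congˡ (a≈ka′ X))
      (*-Solver.solve 3 (λ s k p → s ⊕* (k ⊕* p) ⊜* k ⊕* (s ⊕* p)) refl (sgn (inv S Y)) k (a′ X))

  ∂-+ₑ : (a b : 𝓔 n) → ∂ (a +ₑ b) ≈ₑ ∂ a +ₑ ∂ b
  ∂-+ₑ {n} a b Y = trans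
    (Σ-cong ss λ S → trans (Σ-cong ss λ X → trans (?-cong (guard S X) (distribˡ _ _ _)) (?-+ (guard S X) _ _))
                           (Σ-+ ss _ _))
    (Σ-+ ss _ _)
    where
    ss = allSubsets n
    guard = λ S X → (∣ S ∣ ≡ᵇ 1) ∧ disjointUnion S Y X

  ∂-cong : {a a′ : 𝓔 n} → a ≈ₑ a′ → ∂ a ≈ₑ ∂ a′
  ∂-cong {n} a≈a′ Y = Σ-cong (allSubsets n) λ S → Σ-cong (allSubsets n) λ X →
    ?-cong ((∣ S ∣ ≡ᵇ 1) ∧ disjointUnion S Y X) (*-congˡ (a≈a′ X))

  ∂-·ₑ : ∀ k (a : 𝓔 n) → ∂ (k ·ₑ a) ≈ₑ k ·ₑ ∂ a
  ∂-·ₑ k a = ∂-by-coefficients-· k (λ X → refl)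

  ∂--ₑ : (a : 𝓔 n) → ∂ (-ₑ a) ≈ₑ -ₑ ∂ a
  ∂--ₑ a Y = trans (∂-by-coefficients-· (- 1#) (λ X → sym (-1*x≈-x _)) Y) (-1*x≈-x _)

  ∂-zero : ∂ (zeroₑ {n}) ≈ₑ zeroₑ
  ∂-zero Y = trans (∂-by-coefficients-· 0# (λ X → sym (zeroˡ 0#)) Y) (zeroˡ _)

  α-cong : {a a′ : 𝓔 n} → a ≈ₑ a′ → α a ≈ₑ α a′
  α-cong a≈a′ X = *-congˡ (a≈a′ X)

  α-involutive : (a : 𝓔 n) → α (α a) ≈ₑ a
  α-involutive a X = trans (sym (*-assoc _ _ _)) (trans (*-congʳ (sgn*sgn≈1 ∣ X ∣)) (*-identityˡ _))

  α-+ₑ : (a b : 𝓔 n) → α (a +ₑ b) ≈ₑ α a +ₑ α b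
  α-+ₑ a b X = distribˡ _ _ _

  α-zero : α (zeroₑ {n}) ≈ₑ zeroₑ
  α-zero X = zeroʳ _

  hi-α : (a : 𝓔 (suc n)) → hi (α a) ≈ₑ -ₑ α (hi a)
  hi-α a Z = sym (-‿distribˡ-* _ _)

  α-∧ₑ : ∀ n (a b : 𝓔 n) → α (a ∧ₑ b) ≈ₑ α a ∧ₑ α b
  α-∧ₑ zero a b [] = begin
    1# * (a ∧ₑ b) []           ≈⟨ *-identityˡ _ ⟩
    (a ∧ₑ b) []                ≈⟨ ∧ₑ-[] a b ⟩
    a [] * b []                ≈⟨ sym (*-cong (*-identityˡ _) (*-identityˡ _)) ⟩
    (1# * a []) * (1# * b [])  ≈⟨ sym (∧ₑ-[] (α a) (α b)) ⟩
    (α a ∧ₑ α b) []            ∎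
  α-∧ₑ (suc n) a b (false ∷ Z) = begin
    sgn ∣ Z ∣ * (a ∧ₑ b) (false ∷ Z)  ≈⟨ *-congˡ (∧ₑ-lo a b Z) ⟩
    α (lo a ∧ₑ lo b) Z                ≈⟨ α-∧ₑ n (lo a) (lo b) Z ⟩
    (α (lo a) ∧ₑ α (lo b)) Z          ≈⟨ sym (∧ₑ-lo (α a) (α b) Z) ⟩
    (α a ∧ₑ α b) (false ∷ Z)          ∎
  α-∧ₑ (suc n) a b (true ∷ Z) = trans lhs (sym rhs)
    where
    s = sgn ∣ Z ∣
    lhs : α (a ∧ₑ b) (true ∷ Z) ≈ - (α (hi a) ∧ₑ α (lo b)) Z + - (lo a ∧ₑ α (hi b)) Z
    lhs = begin
      (- s) * (a ∧ₑ b) (true ∷ Z)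
        ≈⟨ sym (-‿distribˡ-* _ _) ⟩
      - (s * (a ∧ₑ b) (true ∷ Z))
        ≈⟨ -‿cong (*-congˡ (∧ₑ-hi a b Z)) ⟩
      - (s * ((hi a ∧ₑ lo b) Z + (α (lo a) ∧ₑ hi b) Z))
        ≈⟨ -‿cong (distribˡ _ _ _) ⟩
      - (α (hi a ∧ₑ lo b) Z + α (α (lo a) ∧ₑ hi b) Z)
        ≈⟨ -‿cong (+-cong (α-∧ₑ n _ _ Z) (α-∧ₑ n _ _ Z)) ⟩
      - ((α (hi a) ∧ₑ α (lo b)) Z + (α (α (lo a)) ∧ₑ α (hi b)) Z)
        ≈⟨ -‿cong (+-congˡ (∧ₑ-congʳ (α-involutive (lo a)) Z)) ⟩
      - ((α (hi a) ∧ₑ α (lo b)) Z + (lo a ∧ₑ α (hi b)) Z)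
        ≈⟨ -‿distrib-+ _ _ ⟩
      - (α (hi a) ∧ₑ α (lo b)) Z + - (lo a ∧ₑ α (hi b)) Z
        ∎
    rhs : (α a ∧ₑ α b) (true ∷ Z) ≈ - (α (hi a) ∧ₑ α (lo b)) Z + - (lo a ∧ₑ α (hi b)) Z
    rhs = begin
      (α a ∧ₑ α b) (true ∷ Z)
        ≈⟨ ∧ₑ-hi (α a) (α b) Z ⟩
      (hi (α a) ∧ₑ α (lo b)) Z + (α (α (lo a)) ∧ₑ hi (α b)) Z
        ≈⟨ +-cong (∧ₑ-congʳ (hi-α a) Z) (∧ₑ-cong (α-involutive (lo a)) (hi-α b) Z) ⟩
      (-ₑ α (hi a) ∧ₑ α (lo b)) Z + (lo a ∧ₑ -ₑ α (hi b)) Z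
        ≈⟨ +-cong (-ₑ‿distribˡ-∧ₑ _ _ Z) (-ₑ‿distribʳ-∧ₑ _ _ Z) ⟩
      - (α (hi a) ∧ₑ α (lo b)) Z + - (lo a ∧ₑ α (hi b)) Z
        ∎

  ∧ₑ-assoc : ∀ n (a b c : 𝓔 n) → (a ∧ₑ b) ∧ₑ c ≈ₑ a ∧ₑ (b ∧ₑ c)
  ∧ₑ-assoc zero a b c [] = begin
    ((a ∧ₑ b) ∧ₑ c) []    ≈⟨ ∧ₑ-[] (a ∧ₑ b) c ⟩
    (a ∧ₑ b) [] * c []    ≈⟨ *-congʳ (∧ₑ-[] a b) ⟩
    (a [] * b []) * c []  ≈⟨ *-assoc _ _ _ ⟩
    a [] * (b [] * c [])  ≈⟨ sym (*-congˡ (∧ₑ-[] b c)) ⟩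
    a [] * (b ∧ₑ c) []    ≈⟨ sym (∧ₑ-[] a (b ∧ₑ c)) ⟩
    (a ∧ₑ (b ∧ₑ c)) []    ∎
  ∧ₑ-assoc (suc n) a b c (false ∷ Z) = begin
    ((a ∧ₑ b) ∧ₑ c) (false ∷ Z)  ≈⟨ ∧ₑ-lo _ _ Z ⟩
    (lo (a ∧ₑ b) ∧ₑ lo c) Z      ≈⟨ ∧ₑ-congʳ (∧ₑ-lo a b) Z ⟩
    ((lo a ∧ₑ lo b) ∧ₑ lo c) Z   ≈⟨ ∧ₑ-assoc n _ _ _ Z ⟩
    (lo a ∧ₑ (lo b ∧ₑ lo c)) Z   ≈⟨ sym (∧ₑ-congˡ (∧ₑ-lo b c) Z) ⟩
    (lo a ∧ₑ lo (b ∧ₑ c)) Z      ≈⟨ sym (∧ₑ-lo _ _ Z) ⟩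
    (a ∧ₑ (b ∧ₑ c)) (false ∷ Z)  ∎
  ∧ₑ-assoc (suc n) a b c (true ∷ Z) = trans lhs (sym rhs)
    where
    x = (hi a ∧ₑ (lo b ∧ₑ lo c)) Z
    y = (α (lo a) ∧ₑ (hi b ∧ₑ lo c)) Z
    z = (α (lo a) ∧ₑ (α (lo b) ∧ₑ hi c)) Z
    lhs : ((a ∧ₑ b) ∧ₑ c) (true ∷ Z) ≈ (x + y) + z
    lhs = begin
      ((a ∧ₑ b) ∧ₑ c) (true ∷ Z)
        ≈⟨ ∧ₑ-hi _ _ Z ⟩
      (hi (a ∧ₑ b) ∧ₑ lo c) Z + (α (lo (a ∧ₑ b)) ∧ₑ hi c) Z
        ≈⟨ +-cong (∧ₑ-congʳ (∧ₑ-hi a b) Z) (∧ₑ-congʳ (λ X → trans (α-cong (∧ₑ-lo a b) X) (α-∧ₑ n _ _ X)) Z) ⟩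
      ((hi a ∧ₑ lo b +ₑ α (lo a) ∧ₑ hi b) ∧ₑ lo c) Z + ((α (lo a) ∧ₑ α (lo b)) ∧ₑ hi c) Z
        ≈⟨ +-cong (∧ₑ-distribʳ-+ₑ _ _ _ Z) (∧ₑ-assoc n _ _ _ Z) ⟩
      ((hi a ∧ₑ lo b) ∧ₑ lo c) Z + ((α (lo a) ∧ₑ hi b) ∧ₑ lo c) Z + z
        ≈⟨ +-congʳ (+-cong (∧ₑ-assoc n _ _ _ Z) (∧ₑ-assoc n _ _ _ Z)) ⟩
      (x + y) + z
        ∎
    rhs : (a ∧ₑ (b ∧ₑ c)) (true ∷ Z) ≈ (x + y) + z
    rhs = begin
      (a ∧ₑ (b ∧ₑ c)) (true ∷ Z)
        ≈⟨ ∧ₑ-hi _ _ Z ⟩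
      (hi a ∧ₑ lo (b ∧ₑ c)) Z + (α (lo a) ∧ₑ hi (b ∧ₑ c)) Z
        ≈⟨ +-cong (∧ₑ-congˡ (∧ₑ-lo b c) Z) (∧ₑ-congˡ (∧ₑ-hi b c) Z) ⟩
      x + (α (lo a) ∧ₑ (hi b ∧ₑ lo c +ₑ α (lo b) ∧ₑ hi c)) Z
        ≈⟨ +-congˡ (∧ₑ-distribˡ-+ₑ _ _ _ Z) ⟩
      x + (y + z)
        ≈⟨ sym (+-assoc _ _ _) ⟩
      (x + y) + z
        ∎

  ∂-α : ∀ n (a : 𝓔 n) → ∂ (α a) ≈ₑ -ₑ α (∂ a)
  ∂-α zero a [] = trans (∂-[] (α a)) (sym (trans (-‿cong (trans (*-identityˡ _) (∂-[] a))) -0#≈0#))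
  ∂-α (suc n) a (false ∷ Z) = begin
    ∂ (α a) (false ∷ Z)                    ≈⟨ ∂-lo (α a) Z ⟩
    ∂ (α (lo a)) Z + hi (α a) Z            ≈⟨ +-cong (∂-α n (lo a) Z) (hi-α a Z) ⟩
    - α (∂ (lo a)) Z + - α (hi a) Z        ≈⟨ sym (-‿distrib-+ _ _) ⟩
    - (α (∂ (lo a)) Z + α (hi a) Z)        ≈⟨ -‿cong (sym (distribˡ _ _ _)) ⟩
    - (sgn ∣ Z ∣ * (∂ (lo a) Z + hi a Z))  ≈⟨ -‿cong (*-congˡ (sym (∂-lo a Z))) ⟩
    - (sgn ∣ Z ∣ * ∂ a (false ∷ Z))        ∎
  ∂-α (suc n) a (true ∷ Z) = begin
    ∂ (α a) (true ∷ Z)                  ≈⟨ ∂-hi (α a) Z ⟩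
    - ∂ (hi (α a)) Z                    ≈⟨ -‿cong (∂-cong (hi-α a) Z) ⟩
    - ∂ (-ₑ α (hi a)) Z                 ≈⟨ -‿cong (∂--ₑ _ Z) ⟩
    - (- ∂ (α (hi a)) Z)                ≈⟨ -‿involutive _ ⟩
    ∂ (α (hi a)) Z                      ≈⟨ ∂-α n (hi a) Z ⟩
    - (sgn ∣ Z ∣ * ∂ (hi a) Z)          ≈⟨ -‿cong (sym (-x*-y≈x*y _ _)) ⟩
    - ((- sgn ∣ Z ∣) * (- ∂ (hi a) Z))  ≈⟨ -‿cong (*-congˡ (sym (∂-hi a Z))) ⟩
    - ((- sgn ∣ Z ∣) * ∂ a (true ∷ Z))  ∎

  ∂∂≈0 : ∀ n (a : 𝓔 n) → ∂ (∂ a) ≈ₑ zeroₑ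
  ∂∂≈0 zero a [] = ∂-[] (∂ a)
  ∂∂≈0 (suc n) a (false ∷ Z) = begin
    ∂ (∂ a) (false ∷ Z)                           ≈⟨ ∂-lo (∂ a) Z ⟩
    ∂ (lo (∂ a)) Z + hi (∂ a) Z                   ≈⟨ +-cong (∂-cong (∂-lo a) Z) (∂-hi a Z) ⟩
    ∂ (∂ (lo a) +ₑ hi a) Z + - ∂ (hi a) Z         ≈⟨ +-congʳ (∂-+ₑ _ _ Z) ⟩
    (∂ (∂ (lo a)) Z + ∂ (hi a) Z) + - ∂ (hi a) Z  ≈⟨ +-congʳ (0+y≈y (∂∂≈0 n (lo a) Z)) ⟩
    ∂ (hi a) Z + - ∂ (hi a) Z                     ≈⟨ -‿inverseʳ _ ⟩
    0#                                            ∎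
  ∂∂≈0 (suc n) a (true ∷ Z) = begin
    ∂ (∂ a) (true ∷ Z)         ≈⟨ ∂-hi (∂ a) Z ⟩
    - ∂ (hi (∂ a)) Z           ≈⟨ -‿cong (∂-cong (∂-hi a) Z) ⟩
    - ∂ (-ₑ ∂ (hi a)) Z        ≈⟨ -‿cong (∂--ₑ _ Z) ⟩
    - (- ∂ (∂ (hi a)) Z)       ≈⟨ -‿involutive _ ⟩
    ∂ (∂ (hi a)) Z             ≈⟨ ∂∂≈0 n (hi a) Z ⟩
    0#                         ∎

  ∂-leibniz : ∀ n (a b : 𝓔 n) → ∂ (a ∧ₑ b) ≈ₑ ∂ a ∧ₑ b +ₑ α a ∧ₑ ∂ b
  ∂-leibniz zero a b [] = begin
    ∂ (a ∧ₑ b) []                      ≈⟨ ∂-[] (a ∧ₑ b) ⟩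
    0#                                 ≈⟨ sym (0+0≈0 ∂a*b≈0 αa*∂b≈0) ⟩
    ∂ a [] * b [] + α a [] * ∂ b []    ≈⟨ sym (+-cong (∧ₑ-[] (∂ a) b) (∧ₑ-[] (α a) (∂ b))) ⟩
    (∂ a ∧ₑ b) [] + (α a ∧ₑ ∂ b) []    ∎
    where
    ∂a*b≈0 = trans (*-congʳ (∂-[] a)) (zeroˡ _)
    αa*∂b≈0 = trans (*-congˡ (∂-[] b)) (zeroʳ _)
  ∂-leibniz (suc n) a b (false ∷ Z) = trans lhs (sym rhs)
    where
    p = (∂ (lo a) ∧ₑ lo b) Z
    q = (α (lo a) ∧ₑ ∂ (lo b)) Z
    r = (hi a ∧ₑ lo b) Z
    s = (α (lo a) ∧ₑ hi b) Z
    lhs : ∂ (a ∧ₑ b) (false ∷ Z) ≈ (p + r) + (q + s)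
    lhs = begin
      ∂ (a ∧ₑ b) (false ∷ Z)             ≈⟨ ∂-lo _ Z ⟩
      ∂ (lo (a ∧ₑ b)) Z + hi (a ∧ₑ b) Z  ≈⟨ +-cong (∂-cong (∧ₑ-lo a b) Z) (∧ₑ-hi a b Z) ⟩
      ∂ (lo a ∧ₑ lo b) Z + (r + s)       ≈⟨ +-congʳ (∂-leibniz n _ _ Z) ⟩
      (p + q) + (r + s)
        ≈⟨ +-Solver.solve 4 (λ p q r s → (p ⊕⁺ q) ⊕⁺ (r ⊕⁺ s) ⊜⁺ (p ⊕⁺ r) ⊕⁺ (q ⊕⁺ s)) refl p q r s ⟩
      (p + r) + (q + s)                  ∎
    rhs : (∂ a ∧ₑ b +ₑ α a ∧ₑ ∂ b) (false ∷ Z) ≈ (p + r) + (q + s)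
    rhs = begin
      (∂ a ∧ₑ b) (false ∷ Z) + (α a ∧ₑ ∂ b) (false ∷ Z)
        ≈⟨ +-cong (∧ₑ-lo _ _ Z) (∧ₑ-lo _ _ Z) ⟩
      (lo (∂ a) ∧ₑ lo b) Z + (α (lo a) ∧ₑ lo (∂ b)) Z
        ≈⟨ +-cong (∧ₑ-congʳ (∂-lo a) Z) (∧ₑ-congˡ (∂-lo b) Z) ⟩
      ((∂ (lo a) +ₑ hi a) ∧ₑ lo b) Z + (α (lo a) ∧ₑ (∂ (lo b) +ₑ hi b)) Z
        ≈⟨ +-cong (∧ₑ-distribʳ-+ₑ _ _ _ Z) (∧ₑ-distribˡ-+ₑ _ _ _ Z) ⟩
      (p + r) + (q + s)
        ∎
  ∂-leibniz (suc n) a b (true ∷ Z) = trans lhs (sym rhs)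
    where
    p = (∂ (hi a) ∧ₑ lo b) Z
    q = (α (hi a) ∧ₑ ∂ (lo b)) Z
    r = (α (∂ (lo a)) ∧ₑ hi b) Z
    s = (lo a ∧ₑ ∂ (hi b)) Z
    t = (α (hi a) ∧ₑ hi b) Z
    lhs : ∂ (a ∧ₑ b) (true ∷ Z) ≈ (- p + - q) + (r + - s)
    lhs = begin
      ∂ (a ∧ₑ b) (true ∷ Z)
        ≈⟨ ∂-hi _ Z ⟩
      - ∂ (hi (a ∧ₑ b)) Z
        ≈⟨ -‿cong (∂-cong (∧ₑ-hi a b) Z) ⟩
      - ∂ (hi a ∧ₑ lo b +ₑ α (lo a) ∧ₑ hi b) Z
        ≈⟨ -‿cong (∂-+ₑ _ _ Z) ⟩
      - (∂ (hi a ∧ₑ lo b) Z + ∂ (α (lo a) ∧ₑ hi b) Z)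
        ≈⟨ -‿cong (+-cong (∂-leibniz n _ _ Z) (∂-leibniz n _ _ Z)) ⟩
      - ((p + q) + ((∂ (α (lo a)) ∧ₑ hi b) Z + (α (α (lo a)) ∧ₑ ∂ (hi b)) Z))
        ≈⟨ -‿cong (+-congˡ (+-cong (trans (∧ₑ-congʳ (∂-α n (lo a)) Z) (-ₑ‿distribˡ-∧ₑ _ _ Z))
                                   (∧ₑ-congʳ (α-involutive (lo a)) Z))) ⟩
      - ((p + q) + (- r + s))
        ≈⟨ -‿distrib-+ _ _ ⟩
      - (p + q) + - (- r + s)
        ≈⟨ +-cong (-‿distrib-+ _ _) (trans (-‿distrib-+ _ _) (+-congʳ (-‿involutive _))) ⟩
      (- p + - q) + (r + - s)
        ∎
    rhs : (∂ a ∧ₑ b +ₑ α a ∧ₑ ∂ b) (true ∷ Z) ≈ (- p + - q) + (r + - s)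
    rhs = begin
      (∂ a ∧ₑ b) (true ∷ Z) + (α a ∧ₑ ∂ b) (true ∷ Z)
        ≈⟨ +-cong (∧ₑ-hi _ _ Z) (∧ₑ-hi _ _ Z) ⟩
      ((hi (∂ a) ∧ₑ lo b) Z + (α (lo (∂ a)) ∧ₑ hi b) Z)
        + ((hi (α a) ∧ₑ lo (∂ b)) Z + (α (α (lo a)) ∧ₑ hi (∂ b)) Z)
        ≈⟨ +-cong (+-cong (trans (∧ₑ-congʳ (∂-hi a) Z) (-ₑ‿distribˡ-∧ₑ _ _ Z))
                          (trans (∧ₑ-congʳ (λ X → trans (α-cong (∂-lo a) X) (α-+ₑ (∂ (lo a)) (hi a) X)) Z)
                                 (∧ₑ-distribʳ-+ₑ _ _ _ Z)))
                  (+-cong (trans (∧ₑ-cong (hi-α a) (∂-lo b) Z)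
                                 (trans (-ₑ‿distribˡ-∧ₑ _ _ Z) (-‿cong (∧ₑ-distribˡ-+ₑ _ _ _ Z))))
                          (trans (∧ₑ-cong (α-involutive (lo a)) (∂-hi b) Z) (-ₑ‿distribʳ-∧ₑ _ _ Z))) ⟩
      (- p + (r + t)) + (- (q + t) + - s)
        ≈⟨ +-congˡ (+-congʳ (-‿distrib-+ _ _)) ⟩
      (- p + (r + t)) + ((- q + - t) + - s)
        ≈⟨ +-Solver.solve 6 (λ x₁ x₂ x₃ x₄ x₅ x₆ → (x₁ ⊕⁺ (x₃ ⊕⁺ x₅)) ⊕⁺ ((x₂ ⊕⁺ x₆) ⊕⁺ x₄)
                                                 ⊜⁺ ((x₁ ⊕⁺ x₂) ⊕⁺ (x₃ ⊕⁺ x₄)) ⊕⁺ (x₅ ⊕⁺ x₆))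
                            refl (- p) (- q) r (- s) t (- t) ⟩
      ((- p + - q) + (r + - s)) + (t + - t)
        ≈⟨ x+0≈x (-‿inverseʳ t) ⟩
      (- p + - q) + (r + - s)
        ∎

  α-e : ∀ n (X : Subset n) → α (e X) ≈ₑ sgn ∣ X ∣ ·ₑ e X
  α-e zero    []          []          = refl
  α-e (suc n) (false ∷ X) (false ∷ Z) = α-e n X Z
  α-e (suc n) (false ∷ X) (true ∷ Z)  = trans (zeroʳ _) (sym (zeroʳ _))
  α-e (suc n) (true ∷ X)  (false ∷ Z) = trans (zeroʳ _) (sym (zeroʳ _))
  α-e (suc n) (true ∷ X)  (true ∷ Z)  =
    trans (sym (-‿distribˡ-* _ _)) (trans (-‿cong (α-e n X Z)) (-‿distribˡ-* _ _))

  α-1ₑ : ∀ n → α (1ₑ {n}) ≈ₑ 1ₑ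
  α-1ₑ n Z = trans (α-e n ⊥ Z) (trans (*-congʳ (reflexive (≡.cong sgn (∣⊥∣≡0 n)))) (*-identityˡ _))

  α-e⁅i⁆ : (i : Fin n) → α (e ⁅ i ⁆) ≈ₑ -ₑ e ⁅ i ⁆
  α-e⁅i⁆ {n} i Z = trans (α-e n ⁅ i ⁆ Z) (trans (*-congʳ (reflexive (≡.cong sgn (∣⁅x⁆∣≡1 i)))) (-1*x≈-x _))

  α-∂-e : ∀ n (X : Subset n) → α (∂ (e X)) ≈ₑ (- sgn ∣ X ∣) ·ₑ ∂ (e X)
  α-∂-e n X Z = begin
    α (∂ (e X)) Z               ≈⟨ sym (-‿involutive _) ⟩
    - (- α (∂ (e X)) Z)         ≈⟨ -‿cong (sym (∂-α n (e X) Z)) ⟩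
    - ∂ (α (e X)) Z             ≈⟨ -‿cong (∂-cong (α-e n X) Z) ⟩
    - ∂ (sgn ∣ X ∣ ·ₑ e X) Z    ≈⟨ -‿cong (∂-·ₑ _ (e X) Z) ⟩
    - (sgn ∣ X ∣ * ∂ (e X) Z)   ≈⟨ -‿distribˡ-* _ _ ⟩
    (- sgn ∣ X ∣) * ∂ (e X) Z   ∎

  ∧ₑ-identityˡ : ∀ n (a : 𝓔 n) → 1ₑ ∧ₑ a ≈ₑ a
  ∧ₑ-identityˡ zero    a []          = trans (∧ₑ-[] 1ₑ a) (*-identityˡ _)
  ∧ₑ-identityˡ (suc n) a (false ∷ Z) = trans (∧ₑ-lo 1ₑ a Z) (∧ₑ-identityˡ n (lo a) Z)
  ∧ₑ-identityˡ (suc n) a (true ∷ Z)  = trans (∧ₑ-hi 1ₑ a Z)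
    (trans (0+y≈y (∧ₑ-zeroˡ (lo a) Z)) (trans (∧ₑ-congʳ (α-1ₑ n) Z) (∧ₑ-identityˡ n (hi a) Z)))

  ∧ₑ-identityʳ : ∀ n (a : 𝓔 n) → a ∧ₑ 1ₑ ≈ₑ a
  ∧ₑ-identityʳ zero    a []          = trans (∧ₑ-[] a 1ₑ) (*-identityʳ _)
  ∧ₑ-identityʳ (suc n) a (false ∷ Z) = trans (∧ₑ-lo a 1ₑ Z) (∧ₑ-identityʳ n (lo a) Z)
  ∧ₑ-identityʳ (suc n) a (true ∷ Z)  =
    trans (∧ₑ-hi a 1ₑ Z) (trans (x+0≈x (∧ₑ-zeroʳ (α (lo a)) Z)) (∧ₑ-identityʳ n (hi a) Z))

  ∂-1ₑ : ∀ n → ∂ (1ₑ {n}) ≈ₑ zeroₑ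
  ∂-1ₑ zero    []          = ∂-[] 1ₑ
  ∂-1ₑ (suc n) (false ∷ Z) = trans (∂-lo 1ₑ Z) (trans (+-identityʳ _) (∂-1ₑ n Z))
  ∂-1ₑ (suc n) (true ∷ Z)  = trans (∂-hi 1ₑ Z) (trans (-‿cong (∂-zero Z)) -0#≈0#)

  ∂-e⁅i⁆ : (i : Fin n) → ∂ (e ⁅ i ⁆) ≈ₑ 1ₑ
  ∂-e⁅i⁆         zero    (false ∷ Z) = trans (∂-lo (e ⁅ zero ⁆) Z) (0+y≈y (∂-zero Z))
  ∂-e⁅i⁆ {suc n} zero    (true ∷ Z)  = trans (∂-hi (e ⁅ zero ⁆) Z) (trans (-‿cong (∂-1ₑ n Z)) -0#≈0#)
  ∂-e⁅i⁆         (suc i) (false ∷ Z) = trans (∂-lo (e ⁅ suc i ⁆) Z) (trans (+-identityʳ _) (∂-e⁅i⁆ i Z))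
  ∂-e⁅i⁆         (suc i) (true ∷ Z)  = trans (∂-hi (e ⁅ suc i ⁆) Z) (trans (-‿cong (∂-zero Z)) -0#≈0#)

  e-∧ₑ-e-disjoint : (X Y : Subset n) → X ∩ Y ≡ ⊥ → e X ∧ₑ e Y ≈ₑ sgn (inv X Y) ·ₑ e (X ∪ Y)
  e-∧ₑ-e-disjoint []          []          _     []          = ∧ₑ-[] (e []) (e [])
  e-∧ₑ-e-disjoint (true ∷ X)  (true ∷ Y)  ()
  e-∧ₑ-e-disjoint (false ∷ X) (false ∷ Y) X∩Y≡⊥ (false ∷ Z) =
    trans (∧ₑ-lo (e (false ∷ X)) (e (false ∷ Y)) Z) (e-∧ₑ-e-disjoint X Y (∷-injectiveʳ X∩Y≡⊥) Z)
  e-∧ₑ-e-disjoint (false ∷ X) (false ∷ Y) X∩Y≡⊥ (true ∷ Z)  = trans (∧ₑ-hi (e (false ∷ X)) (e (false ∷ Y)) Z)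
    (trans (0+0≈0 (∧ₑ-zeroˡ (e Y) Z) (∧ₑ-zeroʳ (α (e X)) Z)) (sym (zeroʳ _)))
  e-∧ₑ-e-disjoint (true ∷ X)  (false ∷ Y) X∩Y≡⊥ (false ∷ Z) =
    trans (∧ₑ-lo (e (true ∷ X)) (e (false ∷ Y)) Z) (trans (∧ₑ-zeroˡ (e Y) Z) (sym (zeroʳ _)))
  e-∧ₑ-e-disjoint (true ∷ X)  (false ∷ Y) X∩Y≡⊥ (true ∷ Z)  = trans (∧ₑ-hi (e (true ∷ X)) (e (false ∷ Y)) Z)
    (trans (x+0≈x (∧ₑ-zeroʳ (α zeroₑ) Z)) (e-∧ₑ-e-disjoint X Y (∷-injectiveʳ X∩Y≡⊥) Z))
  e-∧ₑ-e-disjoint (false ∷ X) (true ∷ Y)  X∩Y≡⊥ (false ∷ Z) =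
    trans (∧ₑ-lo (e (false ∷ X)) (e (true ∷ Y)) Z) (trans (∧ₑ-zeroʳ (e X) Z) (sym (zeroʳ _)))
  e-∧ₑ-e-disjoint (false ∷ X) (true ∷ Y)  X∩Y≡⊥ (true ∷ Z)  = begin
    (e (false ∷ X) ∧ₑ e (true ∷ Y)) (true ∷ Z)  ≈⟨ ∧ₑ-hi (e (false ∷ X)) (e (true ∷ Y)) Z ⟩
    (zeroₑ ∧ₑ zeroₑ) Z + (α (e X) ∧ₑ e Y) Z     ≈⟨ 0+y≈y (∧ₑ-zeroˡ zeroₑ Z) ⟩
    (α (e X) ∧ₑ e Y) Z                          ≈⟨ ∧ₑ-congʳ (α-e _ X) Z ⟩
    ((sgn ∣ X ∣ ·ₑ e X) ∧ₑ e Y) Z               ≈⟨ ·ₑ-∧ₑ (sgn ∣ X ∣) (e X) (e Y) Z ⟩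
    sgn ∣ X ∣ * (e X ∧ₑ e Y) Z                  ≈⟨ *-congˡ (e-∧ₑ-e-disjoint X Y (∷-injectiveʳ X∩Y≡⊥) Z) ⟩
    sgn ∣ X ∣ * (sgn (inv X Y) * e (X ∪ Y) Z)   ≈⟨ sym (*-assoc _ _ _) ⟩
    (sgn ∣ X ∣ * sgn (inv X Y)) * e (X ∪ Y) Z   ≈⟨ *-congʳ (sym (sgn-+ ∣ X ∣ (inv X Y))) ⟩
    sgn (∣ X ∣ +ℕ inv X Y) * e (X ∪ Y) Z        ∎

  e-∪ : (X Y : Subset n) → X ∩ Y ≡ ⊥ → e (X ∪ Y) ≈ₑ sgn (inv X Y) ·ₑ (e X ∧ₑ e Y)
  e-∪ X Y X∩Y≡⊥ Z = sym (begin
    σ * (e X ∧ₑ e Y) Z     ≈⟨ *-congˡ (e-∧ₑ-e-disjoint X Y X∩Y≡⊥ Z) ⟩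
    σ * (σ * e (X ∪ Y) Z)  ≈⟨ sym (*-assoc _ _ _) ⟩
    (σ * σ) * e (X ∪ Y) Z  ≈⟨ *-congʳ (sgn*sgn≈1 (inv X Y)) ⟩
    1# * e (X ∪ Y) Z       ≈⟨ *-identityˡ _ ⟩
    e (X ∪ Y) Z            ∎)
    where σ = sgn (inv X Y)

  e⁅i⁆-∧ₑ-e : (i : Fin n) (X : Subset n) → i ∈ X → e ⁅ i ⁆ ∧ₑ e X ≈ₑ zeroₑ
  e⁅i⁆-∧ₑ-e zero    (true ∷ X)  here        (false ∷ Z) =
    trans (∧ₑ-lo (e ⁅ zero ⁆) (e (true ∷ X)) Z) (∧ₑ-zeroˡ zeroₑ Z)
  e⁅i⁆-∧ₑ-e zero    (true ∷ X)  here        (true ∷ Z)  = trans (∧ₑ-hi (e ⁅ zero ⁆) (e (true ∷ X)) Z)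
    (0+0≈0 (∧ₑ-zeroʳ 1ₑ Z) (trans (∧ₑ-congʳ α-zero Z) (∧ₑ-zeroˡ (e X) Z)))
  e⁅i⁆-∧ₑ-e (suc i) (false ∷ X) (there i∈X) (false ∷ Z) =
    trans (∧ₑ-lo (e ⁅ suc i ⁆) (e (false ∷ X)) Z) (e⁅i⁆-∧ₑ-e i X i∈X Z)
  e⁅i⁆-∧ₑ-e (suc i) (false ∷ X) (there i∈X) (true ∷ Z)  = trans (∧ₑ-hi (e ⁅ suc i ⁆) (e (false ∷ X)) Z)
    (0+0≈0 (∧ₑ-zeroˡ (e X) Z) (∧ₑ-zeroʳ (α (e ⁅ i ⁆)) Z))
  e⁅i⁆-∧ₑ-e (suc i) (true ∷ X)  (there i∈X) (false ∷ Z) =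
    trans (∧ₑ-lo (e ⁅ suc i ⁆) (e (true ∷ X)) Z) (∧ₑ-zeroʳ (e ⁅ i ⁆) Z)
  e⁅i⁆-∧ₑ-e (suc i) (true ∷ X)  (there i∈X) (true ∷ Z)  = begin
    (e ⁅ suc i ⁆ ∧ₑ e (true ∷ X)) (true ∷ Z)      ≈⟨ ∧ₑ-hi (e ⁅ suc i ⁆) (e (true ∷ X)) Z ⟩
    (zeroₑ ∧ₑ zeroₑ) Z + (α (e ⁅ i ⁆) ∧ₑ e X) Z  ≈⟨ 0+y≈y (∧ₑ-zeroˡ zeroₑ Z) ⟩
    (α (e ⁅ i ⁆) ∧ₑ e X) Z                       ≈⟨ ∧ₑ-congʳ (α-e⁅i⁆ i) Z ⟩
    (-ₑ e ⁅ i ⁆ ∧ₑ e X) Z                        ≈⟨ -ₑ‿distribˡ-∧ₑ (e ⁅ i ⁆) (e X) Z ⟩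
    - (e ⁅ i ⁆ ∧ₑ e X) Z                         ≈⟨ -‿cong (e⁅i⁆-∧ₑ-e i X i∈X Z) ⟩
    - 0#                                          ≈⟨ -0#≈0# ⟩
    0#                                            ∎

  ∂-homotopy : (i : Fin n) (a : 𝓔 n) → ∂ (e ⁅ i ⁆ ∧ₑ a) +ₑ e ⁅ i ⁆ ∧ₑ ∂ a ≈ₑ a
  ∂-homotopy {n} i a Z = begin
    ∂ (e ⁅ i ⁆ ∧ₑ a) Z + w                               ≈⟨ +-congʳ (∂-leibniz n _ _ Z) ⟩
    (∂ (e ⁅ i ⁆) ∧ₑ a) Z + (α (e ⁅ i ⁆) ∧ₑ ∂ a) Z + w  ≈⟨ +-congʳ (+-cong ∂eᵢ∧a≈a αeᵢ∧∂a≈-w) ⟩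
    a Z + - w + w                                        ≈⟨ +-assoc _ _ _ ⟩
    a Z + (- w + w)                                      ≈⟨ x+0≈x (-‿inverseˡ w) ⟩
    a Z                                                  ∎
    where
    w = (e ⁅ i ⁆ ∧ₑ ∂ a) Z
    ∂eᵢ∧a≈a : (∂ (e ⁅ i ⁆) ∧ₑ a) Z ≈ a Z
    ∂eᵢ∧a≈a = trans (∧ₑ-congʳ (∂-e⁅i⁆ i) Z) (∧ₑ-identityˡ n a Z)
    αeᵢ∧∂a≈-w : (α (e ⁅ i ⁆) ∧ₑ ∂ a) Z ≈ - w
    αeᵢ∧∂a≈-w = trans (∧ₑ-congʳ (α-e⁅i⁆ i) Z) (-ₑ‿distribˡ-∧ₑ _ _ Z)

  e≈e⁅i⁆∧ₑ∂e : (i : Fin n) (X : Subset n) → i ∈ X → e X ≈ₑ e ⁅ i ⁆ ∧ₑ ∂ (e X)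
  e≈e⁅i⁆∧ₑ∂e i X i∈X Z = begin
    e X Z                                          ≈⟨ sym (∂-homotopy i (e X) Z) ⟩
    ∂ (e ⁅ i ⁆ ∧ₑ e X) Z + (e ⁅ i ⁆ ∧ₑ ∂ (e X)) Z  ≈⟨ 0+y≈y ∂[eᵢ∧eX]≈0 ⟩
    (e ⁅ i ⁆ ∧ₑ ∂ (e X)) Z                         ∎
    where ∂[eᵢ∧eX]≈0 = trans (∂-cong (e⁅i⁆-∧ₑ-e i X i∈X) Z) (∂-zero Z)

  ∧ₑ-homotopy : (i : Fin n) (a b : 𝓔 n) → a ∧ₑ b ≈ₑ a ∧ₑ ∂ (e ⁅ i ⁆ ∧ₑ b) +ₑ (a ∧ₑ e ⁅ i ⁆) ∧ₑ ∂ b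
  ∧ₑ-homotopy {n} i a b Z = begin
    (a ∧ₑ b) Z                                              ≈⟨ ∧ₑ-congˡ (≈ₑ-sym (∂-homotopy i b)) Z ⟩
    (a ∧ₑ (∂ (e ⁅ i ⁆ ∧ₑ b) +ₑ e ⁅ i ⁆ ∧ₑ ∂ b)) Z          ≈⟨ ∧ₑ-distribˡ-+ₑ _ _ _ Z ⟩
    (a ∧ₑ ∂ (e ⁅ i ⁆ ∧ₑ b)) Z + (a ∧ₑ (e ⁅ i ⁆ ∧ₑ ∂ b)) Z  ≈⟨ +-congˡ (sym (∧ₑ-assoc n _ _ _ Z)) ⟩
    (a ∧ₑ ∂ (e ⁅ i ⁆ ∧ₑ b)) Z + ((a ∧ₑ e ⁅ i ⁆) ∧ₑ ∂ b) Z  ∎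

module IdealProperties {c ℓ} (R : CommutativeRing c ℓ) where
  open CommutativeRing R renaming (Carrier to K) hiding (zero)
  open ExteriorAlgebra R
    renaming (_∧ₑ_ to infixr 7 _∧ₑ_; _+ₑ_ to infixl 6 _+ₑ_; _≈ₑ_ to infix 4 _≈ₑ_)
  open ExteriorAlgebraProperties R

  module _ {a} {𝔛 : Subset n → Set a} where
    Ideal-resp : {x y : 𝓔 n} → x ≈ₑ y → Ideal 𝔛 x → Ideal 𝔛 y
    Ideal-resp x≈y (ts , 𝔛ts , x≈Σts) = ts , 𝔛ts , λ Z → trans (sym (x≈y Z)) (x≈Σts Z)

    Ideal-zero : Ideal 𝔛 zeroₑ
    Ideal-zero = [] , [] , λ _ → refl

    Ideal-cons : ∀ {u X v y} → 𝔛 X → Ideal 𝔛 y → Ideal 𝔛 ((u ∧ₑ ∂ (e X)) ∧ₑ v +ₑ y)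
    Ideal-cons {u} {X} {v} 𝔛X (ts , 𝔛ts , y≈Σts) =
      (u , X , v) ∷ ts , 𝔛X ∷ 𝔛ts , λ Z → +-congˡ (y≈Σts Z)

    module _ {p} (P : 𝓔 n → Set p) (P-resp : ∀ {x y} → x ≈ₑ y → P x → P y) (P-zero : P zeroₑ)
             (P-cons : ∀ {u X v y} → 𝔛 X → P y → P ((u ∧ₑ ∂ (e X)) ∧ₑ v +ₑ y)) where
      Ideal-elim : ∀ {x} → Ideal 𝔛 x → P x
      Ideal-elim x∈I = elim _ x∈I ≡.refl
        where
        -- the list is made explicit so that the recursion is structural
        elim : ∀ ts {x} (x∈I : Ideal 𝔛 x) → proj₁ x∈I ≡ ts → P x
        elim []       ([] , [] , x≈0) ≡.refl = P-resp (≈ₑ-sym x≈0) P-zero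
        elim (_ ∷ ts) (_ , 𝔛X ∷ 𝔛ts , x≈) ≡.refl =
          P-resp (≈ₑ-sym x≈) (P-cons 𝔛X (elim ts (ts , 𝔛ts , λ _ → refl) ≡.refl))

    Ideal-+ : ∀ {x y} → Ideal 𝔛 x → Ideal 𝔛 y → Ideal 𝔛 (x +ₑ y)
    Ideal-+ {y = y} x∈I y∈I = Ideal-elim (λ x → Ideal 𝔛 (x +ₑ y))
      (λ x≈x′ → Ideal-resp (λ Z → +-congʳ (x≈x′ Z)))
      (Ideal-resp (λ _ → sym (+-identityˡ _)) y∈I)
      (λ 𝔛X x+y∈I → Ideal-resp (λ _ → sym (+-assoc _ _ _)) (Ideal-cons 𝔛X x+y∈I))
      x∈I

    Ideal-∧ₑˡ : ∀ b {x} → Ideal 𝔛 x → Ideal 𝔛 (b ∧ₑ x)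
    Ideal-∧ₑˡ b = Ideal-elim (λ x → Ideal 𝔛 (b ∧ₑ x))
      (λ x≈x′ → Ideal-resp (∧ₑ-congˡ x≈x′))
      (Ideal-resp (≈ₑ-sym (∧ₑ-zeroʳ b)) Ideal-zero)
      (λ {u} {X} {v} {y} 𝔛X b∧y∈I → Ideal-resp (≈ₑ-sym (regroup u X v y)) (Ideal-cons 𝔛X b∧y∈I))
      where
      regroup : ∀ u X v y → b ∧ₑ ((u ∧ₑ ∂ (e X)) ∧ₑ v +ₑ y) ≈ₑ ((b ∧ₑ u) ∧ₑ ∂ (e X)) ∧ₑ v +ₑ b ∧ₑ y
      regroup u X v y Z = trans (∧ₑ-distribˡ-+ₑ b _ _ Z)
        (+-congʳ (trans (sym (∧ₑ-assoc n b _ v Z)) (∧ₑ-congʳ (≈ₑ-sym (∧ₑ-assoc n b u _)) Z)))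

    Ideal-∧ₑʳ : ∀ b {x} → Ideal 𝔛 x → Ideal 𝔛 (x ∧ₑ b)
    Ideal-∧ₑʳ b = Ideal-elim (λ x → Ideal 𝔛 (x ∧ₑ b))
      (λ x≈x′ → Ideal-resp (∧ₑ-congʳ x≈x′))
      (Ideal-resp (≈ₑ-sym (∧ₑ-zeroˡ b)) Ideal-zero)
      (λ {u} {X} {v} {y} 𝔛X y∧b∈I → Ideal-resp (≈ₑ-sym (regroup u X v y)) (Ideal-cons 𝔛X y∧b∈I))
      where
      regroup : ∀ u X v y → ((u ∧ₑ ∂ (e X)) ∧ₑ v +ₑ y) ∧ₑ b ≈ₑ (u ∧ₑ ∂ (e X)) ∧ₑ (v ∧ₑ b) +ₑ y ∧ₑ b
      regroup u X v y Z = trans (∧ₑ-distribʳ-+ₑ _ _ b Z) (+-congʳ (∧ₑ-assoc n _ _ b Z))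

    Ideal-·ₑ : ∀ k {x} → Ideal 𝔛 x → Ideal 𝔛 (k ·ₑ x)
    Ideal-·ₑ k {x} x∈I = Ideal-resp (λ Z → trans (·ₑ-∧ₑ k 1ₑ x Z) (*-congˡ (∧ₑ-identityˡ n x Z)))
      (Ideal-∧ₑˡ (k ·ₑ 1ₑ) x∈I)

    Ideal-generator : ∀ {X} → 𝔛 X → Ideal 𝔛 (∂ (e X))
    Ideal-generator {X} 𝔛X = Ideal-resp 1∧∂e∧1+0≈∂e (Ideal-cons 𝔛X Ideal-zero)
      where
      1∧∂e∧1+0≈∂e : (1ₑ ∧ₑ ∂ (e X)) ∧ₑ 1ₑ +ₑ zeroₑ ≈ₑ ∂ (e X)
      1∧∂e∧1+0≈∂e Z = trans (+-identityʳ _) (trans (∧ₑ-identityʳ n _ Z) (∧ₑ-identityˡ n _ Z))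

    Ideal-∂ : ∀ {x} → Ideal 𝔛 x → Ideal 𝔛 (∂ x)
    Ideal-∂ = Ideal-elim (Ideal 𝔛 ∘ ∂)
      (λ x≈x′ → Ideal-resp (∂-cong x≈x′))
      (Ideal-resp (≈ₑ-sym ∂-zero) Ideal-zero)
      (λ 𝔛X ∂y∈I → Ideal-resp (≈ₑ-sym (∂-+ₑ _ _)) (Ideal-+ (∂-term 𝔛X) ∂y∈I))
      where
      ∂-term : ∀ {u X v} → 𝔛 X → Ideal 𝔛 (∂ ((u ∧ₑ ∂ (e X)) ∧ₑ v))
      ∂-term {u} {X} {v} 𝔛X = Ideal-resp (≈ₑ-sym expand)
        (Ideal-+ (Ideal-+ (Ideal-∧ₑʳ v (Ideal-∧ₑˡ (∂ u) d∈I)) (Ideal-resp (≈ₑ-sym vanish) Ideal-zero))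
                 (Ideal-∧ₑʳ (∂ v) (Ideal-∧ₑˡ (α u) αd∈I)))
        where
        d = ∂ (e X)
        d∈I : Ideal 𝔛 d
        d∈I = Ideal-generator 𝔛X
        αd∈I : Ideal 𝔛 (α d)
        αd∈I = Ideal-resp (≈ₑ-sym (α-∂-e n X)) (Ideal-·ₑ _ d∈I)
        vanish : (α u ∧ₑ ∂ d) ∧ₑ v ≈ₑ zeroₑ
        vanish Z = trans (∧ₑ-congʳ (λ W → trans (∧ₑ-congˡ (∂∂≈0 n (e X)) W) (∧ₑ-zeroʳ (α u) W)) Z)
                         (∧ₑ-zeroˡ v Z)
        expand : ∂ ((u ∧ₑ d) ∧ₑ v) ≈ₑ (∂ u ∧ₑ d) ∧ₑ v +ₑ (α u ∧ₑ ∂ d) ∧ₑ v +ₑ (α u ∧ₑ α d) ∧ₑ ∂ v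
        expand Z = trans (∂-leibniz n _ _ Z)
          (+-cong (trans (∧ₑ-congʳ (∂-leibniz n u d) Z) (∧ₑ-distribʳ-+ₑ _ _ v Z)) (∧ₑ-congʳ (α-∧ₑ n u d) Z))

  Ideal-least : ∀ {a b} {𝔛 : Subset n → Set a} {𝔜 : Subset n → Set b} →
                (∀ Y → 𝔜 Y → Ideal 𝔛 (∂ (e Y))) → ∀ {x} → Ideal 𝔜 x → Ideal 𝔛 x
  Ideal-least {𝔛 = 𝔛} generators∈I = Ideal-elim (Ideal 𝔛) Ideal-resp Ideal-zero
    (λ {u} {Y} {v} 𝔜Y y∈I → Ideal-+ (Ideal-∧ₑʳ v (Ideal-∧ₑˡ u (generators∈I Y 𝔜Y))) y∈I)

  module _ {a} {𝔛 : Subset n → Set a} {A B W : Subset n} (A∩B≡⊥ : A ∩ B ≡ ⊥) (A∪B≡W : A ∪ B ≡ W) where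
    Ideal-e-∪⁺ : Ideal 𝔛 (e A ∧ₑ e B) → Ideal 𝔛 (e W)
    Ideal-e-∪⁺ eA∧eB∈I = ≡.subst (Ideal 𝔛 ∘ e) A∪B≡W
      (Ideal-resp (≈ₑ-sym (e-∪ A B A∩B≡⊥)) (Ideal-·ₑ _ eA∧eB∈I))

    Ideal-e-∪⁻ : Ideal 𝔛 (e W) → Ideal 𝔛 (e A ∧ₑ e B)
    Ideal-e-∪⁻ eW∈I = Ideal-resp (≈ₑ-sym (e-∧ₑ-e-disjoint A B A∩B≡⊥))
      (Ideal-·ₑ _ (≡.subst (Ideal 𝔛 ∘ e) (≡.sym A∪B≡W) eW∈I))

module ΔClosureIdeal {c ℓ} (R : CommutativeRing c ℓ) {ℨ : Family n} (nonempty : ∀ X → ℨ X → Nonempty X) where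
  open ExteriorAlgebra R renaming (_∧ₑ_ to infixr 7 _∧ₑ_)
  open ExteriorAlgebraProperties R
  open IdealProperties R

  e∈Ideal : ∀ {X} → Δ-generated ℨ X → Ideal ℨ (e X)
  e∈Ideal (generator {X} ℨX) with nonempty X ℨX
  ... | i , i∈X = Ideal-resp (≈ₑ-sym (e≈e⁅i⁆∧ₑ∂e i X i∈X)) (Ideal-∧ₑˡ (e ⁅ i ⁆) (Ideal-generator ℨX))
  e∈Ideal (superset {X} {Y} X⊆Y X∈Δ) =
    Ideal-e-∪⁺ (p─q∩q≡⊥ Y X) (q⊆p⇒p─q∪q≡p Y X X⊆Y) (Ideal-∧ₑˡ (e (Y ─ X)) (e∈Ideal X∈Δ))
  e∈Ideal (glue {X} {Y} i X∩Y≡⁅i⁆ X∈Δ Y∈Δ) = Ideal-e-∪⁺ A∩B≡⊥ A∪B≡XΔY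
    (Ideal-resp (≈ₑ-sym (∧ₑ-homotopy i (e A) (e B)))
      (Ideal-+ (Ideal-∧ₑˡ (e A) (Ideal-∂ eᵢ∧eB∈I)) (Ideal-∧ₑʳ (∂ (e B)) eA∧eᵢ∈I)))
    where
    A = X ─ ⁅ i ⁆
    B = Y ─ ⁅ i ⁆
    i∈X×i∈Y : i ∈ X × i ∈ Y
    i∈X×i∈Y = x∈p∩q⁻ X Y (≡.subst (i ∈_) (≡.sym X∩Y≡⁅i⁆) (x∈⁅x⁆ i))
    eA∧eᵢ∈I : Ideal ℨ (e A ∧ₑ e ⁅ i ⁆)
    eA∧eᵢ∈I = Ideal-e-∪⁻ (p─q∩q≡⊥ X ⁅ i ⁆) (q⊆p⇒p─q∪q≡p X ⁅ i ⁆ (x∈p⇒⁅x⁆⊆p (proj₁ i∈X×i∈Y)))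
      (e∈Ideal X∈Δ)
    eᵢ∧eB∈I : Ideal ℨ (e ⁅ i ⁆ ∧ₑ e B)
    eᵢ∧eB∈I = Ideal-e-∪⁻ (≡.trans (∩-comm ⁅ i ⁆ B) (p─q∩q≡⊥ Y ⁅ i ⁆))
      (≡.trans (∪-comm ⁅ i ⁆ B) (q⊆p⇒p─q∪q≡p Y ⁅ i ⁆ (x∈p⇒⁅x⁆⊆p (proj₂ i∈X×i∈Y))))
      (e∈Ideal Y∈Δ)
    A∩B≡⊥ : A ∩ B ≡ ⊥
    A∩B≡⊥ = ≡.subst (λ r → (X ─ r) ∩ (Y ─ r) ≡ ⊥) X∩Y≡⁅i⁆ (p─[p∩q]∩q─[p∩q]≡⊥ X Y)
    A∪B≡XΔY : A ∪ B ≡ X Δ Y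
    A∪B≡XΔY = ≡.subst (λ r → (X ─ r) ∪ (Y ─ r) ≡ X Δ Y) X∩Y≡⁅i⁆ (p─[p∩q]∪q─[p∩q]≡pΔq X Y)

  ∂e∈Ideal : ∀ {X} → clΔ ℨ X → Ideal ℨ (∂ (e X))
  ∂e∈Ideal X∈clΔ = Ideal-∂ (e∈Ideal (clΔ⊆Δ-generated ℨ X∈clΔ))

proposition4 : ∀ {c ℓ} (K : CommutativeRing c ℓ) → IsField K →
    ∀ (n : ℕ) (Circ : Family n) → IsSimpleMatroidCircuits Circ →
    ∀ (Circ' : Family n) → (∀ X → Circ' X → Circ X) →
    ∀ (x : ExteriorAlgebra.𝓔 K n) →
      (ExteriorAlgebra.Ideal K Circ' x → ExteriorAlgebra.Ideal K (clΔ Circ') x)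
      × (ExteriorAlgebra.Ideal K (clΔ Circ') x → ExteriorAlgebra.Ideal K Circ' x)
proposition4 K _ n Circ circuits Circ' Circ'⊆Circ x =
    Ideal-least (λ X Circ'X → Ideal-generator (λ _ _ Circ'⊆𝔉 → Circ'⊆𝔉 X Circ'X))
  , Ideal-least (λ X → ∂e∈Ideal)
  where
  open IdealProperties K
  circuit-nonempty : ∀ X → Circ' X → Nonempty X
  circuit-nonempty X Circ'X =
    1≤∣p∣⇒Nonempty X (≤-trans (s≤s z≤n) (IsSimpleMatroidCircuits.simple circuits X (Circ'⊆Circ X Circ'X)))
  open ΔClosureIdeal K circuit-nonempty
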